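{- Let $p$ and $q$ be positive integers, and let $\mu\vdash n$, $\lambda\vdash n$ satisfy $\mu_p>\mu_{p+1}$, $\lambda_q>\lambda_{q+1}$ and $\mu\unrhd\lambda$. Then the following are equivalent: (i) $\mu^{(p)}\unrhd\lambda^{(q)}$; (ii) either $p\ge q$, or $p<q$ and $\sum_{i=1}^j\mu_i>\sum_{i=1}^j\lambda_i$ for all $j$ with $p\le j<q$.
   Context: A partition $\mu\vdash n$ is a non-increasing sequence of positive integers summing to $n$; $\mu_i=0$ beyond its number of parts, and trailing zero parts are deleted. For partitions $\mu=(\mu_1,\dots,\mu_h)$, $\lambda=(\lambda_1,\dots,\lambda_k)$ of the same integer, $\mu\unrhd\lambda$ means $k\ge h$ and $\sum_{i=1}^j\mu_i\ge\sum_{i=1}^j\lambda_i$ for $j=1,\dots,h$. $\mu^{(p)}$ denotes $\mu$ with its $p$-th entry decreased by $1$. -}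

module Defs where

open import Data.Nat using (ℕ; zero; suc; _≤_; _<_; _≥_; _∸_)
open import Data.List using (List; []; _∷_; length; take)
open import Data.Nat.ListAction using (sum)
open import Data.List.Relation.Unary.All using (All)
open import Data.List.Relation.Unary.Linked using (Linked)
open import Data.Product using (_×_)
open import Relation.Binary.PropositionalEquality using (_≡_)

IsPartition : ℕ → List ℕ → Set
IsPartition n μ = Linked _≥_ μ × All (0 <_) μ × sum μ ≡ n

-- entry μ i = μ_i (1-based); μ_i = 0 beyond the number of parts (and for i = 0).
entry : List ℕ → ℕ → ℕ
entry []       _             = 0
entry (x ∷ xs) zero          = 0
entry (x ∷ xs) (suc zero)    = x
entry (x ∷ xs) (suc (suc i)) = entry xs (suc i)

psum : List ℕ → ℕ → ℕ
psum μ j = sum (take j μ)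

-- decrease the p-th entry (1-based) by one (no-op if there is no p-th entry)
decAt : ℕ → List ℕ → List ℕ
decAt _             []       = []
decAt zero          xs       = xs
decAt (suc zero)    (x ∷ xs) = (x ∸ 1) ∷ xs
decAt (suc (suc p)) (x ∷ xs) = x ∷ decAt (suc p) xs

stripZeros : List ℕ → List ℕ
stripZeros [] = []
stripZeros (x ∷ xs) with stripZeros xs | x
... | []     | zero  = []
... | []     | suc y = suc y ∷ []
... | y ∷ ys | x'    = x' ∷ y ∷ ys

_⁽_⁾ : List ℕ → ℕ → List ℕ
μ ⁽ p ⁾ = stripZeros (decAt p μ)

-- dominance μ ⊵ λ (for partitions of the same integer):
-- k ≥ h and partial sums of μ ≥ those of λ for j = 1..h
_⊵_ : List ℕ → List ℕ → Set
μ ⊵ λ′ = (length μ ≤ length λ′) × (∀ j → 1 ≤ j → j ≤ length μ → psum λ′ j ≤ psum μ j)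

-- Both sides of (i) are partitions of n − 1, so μ^(p) ⊵ λ^(q) amounts to comparing
-- all partial sums. Removing a box from row p lowers exactly the partial sums
-- Σ_{i≤j} with j ≥ p by one, so the comparison at j can only fail for
-- p ≤ j < q, where the sum of λ stays and that of μ drops: there the old
-- inequality must have been strict.
module Submission where

open import Defs
open import Data.Nat using (ℕ; zero; suc; _+_; _≤_; _<_; z≤n; s≤s; s≤s⁻¹)
open import Data.Nat.Properties
open import Data.List using (List; []; _∷_; length)
open import Data.Nat.ListAction using (sum)
open import Data.List.Properties using (take-all)
open import Data.Product using (_×_; _,_)
open import Data.Sum using (_⊎_; inj₁; inj₂)
open import Data.Unit using (⊤; tt)
open import Data.Empty using (⊥-elim)
open import Function.Bundles using (_⇔_; mk⇔; Equivalence)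
open import Function.Properties.Equivalence using () renaming (trans to ⇔-trans)
open import Relation.Binary.PropositionalEquality using (_≡_; refl; sym; trans; cong)
open import Relation.Nullary using (yes; no)

psum-≤-sum : ∀ xs j → psum xs j ≤ sum xs
psum-≤-sum []       zero    = z≤n
psum-≤-sum []       (suc j) = z≤n
psum-≤-sum (x ∷ xs) zero    = z≤n
psum-≤-sum (x ∷ xs) (suc j) = +-monoʳ-≤ x (psum-≤-sum xs j)

psum-≥-length : ∀ xs j → length xs ≤ j → psum xs j ≡ sum xs
psum-≥-length xs j le = cong sum (take-all j xs le)

psum-[] : ∀ j → psum [] j ≡ 0
psum-[] zero    = refl
psum-[] (suc j) = refl

psum-stripZeros : ∀ xs j → psum (stripZeros xs) j ≡ psum xs j
psum-stripZeros []       zero    = refl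
psum-stripZeros []       (suc j) = refl
psum-stripZeros (x ∷ xs) j with stripZeros xs | psum-stripZeros xs
psum-stripZeros (zero  ∷ xs) zero    | []     | ih = refl
psum-stripZeros (zero  ∷ xs) (suc j) | []     | ih = trans (sym (psum-[] j)) (ih j)
psum-stripZeros (suc y ∷ xs) zero    | []     | ih = refl
psum-stripZeros (suc y ∷ xs) (suc j) | []     | ih = cong (suc y +_) (ih j)
psum-stripZeros (x ∷ xs)     zero    | _ ∷ _  | ih = refl
psum-stripZeros (x ∷ xs)     (suc j) | _ ∷ _  | ih = cong (x +_) (ih j)

sum-stripZeros : ∀ xs → sum (stripZeros xs) ≡ sum xs
sum-stripZeros []       = refl
sum-stripZeros (x ∷ xs) with stripZeros xs | sum-stripZeros xs
sum-stripZeros (zero  ∷ xs) | []    | ih = ih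
sum-stripZeros (suc y ∷ xs) | []    | ih = cong (suc y +_) ih
sum-stripZeros (x ∷ xs)     | _ ∷ _ | ih = cong (x +_) ih

-- The invariant of lists without trailing zeros that makes the length
-- condition of ⊵ follow from the partial sums.
TailSumsPositive : List ℕ → Set
TailSumsPositive []       = ⊤
TailSumsPositive (x ∷ xs) = 0 < x + sum xs × TailSumsPositive xs

tailSumsPositive-stripZeros : ∀ xs → TailSumsPositive (stripZeros xs)
tailSumsPositive-stripZeros []       = tt
tailSumsPositive-stripZeros (x ∷ xs) with stripZeros xs | tailSumsPositive-stripZeros xs
... | []     | _    with x
...   | zero  = tt
...   | suc y = s≤s z≤n , tt
tailSumsPositive-stripZeros (x ∷ xs) | y ∷ ys | tsp@(pos , _) = ≤-trans pos (m≤n+m _ x) , tsp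

sum≤psum⇒length≤ : ∀ xs j → TailSumsPositive xs → sum xs ≤ psum xs j → length xs ≤ j
sum≤psum⇒length≤ []       j       _         _  = z≤n
sum≤psum⇒length≤ (x ∷ xs) zero    (pos , _) le = ⊥-elim (<⇒≱ pos le)
sum≤psum⇒length≤ (x ∷ xs) (suc j) (_ , tsp) le =
  s≤s (sum≤psum⇒length≤ xs j tsp (+-cancelˡ-≤ x _ _ le))

⊵⇒psum-≤ : ∀ μ λ′ → sum μ ≡ sum λ′ → μ ⊵ λ′ → ∀ j → psum λ′ j ≤ psum μ j
⊵⇒psum-≤ μ λ′ sum≡ _       zero    = z≤n
⊵⇒psum-≤ μ λ′ sum≡ (_ , d) (suc j) with suc j ≤? length μ
... | yes j<len = d (suc j) (s≤s z≤n) j<len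
... | no  j≮len = begin
  psum λ′ (suc j) ≤⟨ psum-≤-sum λ′ (suc j) ⟩
  sum λ′          ≡⟨ sum≡ ⟨
  sum μ           ≡⟨ psum-≥-length μ (suc j) (<⇒≤ (≰⇒> j≮len)) ⟨
  psum μ (suc j)  ∎
  where open ≤-Reasoning

psum-≤⇒⊵ : ∀ μ λ′ → TailSumsPositive μ → sum μ ≡ sum λ′ → (∀ j → psum λ′ j ≤ psum μ j) → μ ⊵ λ′
psum-≤⇒⊵ μ λ′ tsp sum≡ le = sum≤psum⇒length≤ μ (length λ′) tsp (begin
  sum μ               ≡⟨ sum≡ ⟩
  sum λ′              ≡⟨ psum-≥-length λ′ (length λ′) ≤-refl ⟨
  psum λ′ (length λ′) ≤⟨ le (length λ′) ⟩
  psum μ (length λ′)  ∎) , λ j _ _ → le j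
  where open ≤-Reasoning

psum-decAt-< : ∀ p xs j → j < p → psum (decAt p xs) j ≡ psum xs j
psum-decAt-< p             []       zero    _         = refl
psum-decAt-< p             []       (suc j) _         = refl
psum-decAt-< p             (x ∷ xs) zero    _         = refl
psum-decAt-< (suc (suc p)) (x ∷ xs) (suc j) (s≤s j<p) = cong (x +_) (psum-decAt-< (suc p) xs j j<p)

suc-psum-decAt-≥ : ∀ p xs j → 0 < entry xs p → p ≤ j → suc (psum (decAt p xs) j) ≡ psum xs j
suc-psum-decAt-≥ (suc zero)    (suc x ∷ xs) (suc j)       _ _ = refl
suc-psum-decAt-≥ (suc (suc p)) (x ∷ xs)     (suc (suc j)) pos (s≤s p≤j) =
  trans (sym (+-suc x _)) (cong (x +_) (suc-psum-decAt-≥ (suc p) xs (suc j) pos p≤j))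

suc-sum-decAt : ∀ p xs → 0 < entry xs p → suc (sum (decAt p xs)) ≡ sum xs
suc-sum-decAt (suc zero)    (suc x ∷ xs) _   = refl
suc-sum-decAt (suc (suc p)) (x ∷ xs)     pos =
  trans (sym (+-suc x _)) (cong (x +_) (suc-sum-decAt (suc p) xs pos))

psum-⁽⁾-< : ∀ p xs j → j < p → psum (xs ⁽ p ⁾) j ≡ psum xs j
psum-⁽⁾-< p xs j j<p = trans (psum-stripZeros (decAt p xs) j) (psum-decAt-< p xs j j<p)

suc-psum-⁽⁾-≥ : ∀ p xs j → 0 < entry xs p → p ≤ j → suc (psum (xs ⁽ p ⁾) j) ≡ psum xs j
suc-psum-⁽⁾-≥ p xs j pos p≤j =
  trans (cong suc (psum-stripZeros (decAt p xs) j)) (suc-psum-decAt-≥ p xs j pos p≤j)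

suc-sum-⁽⁾ : ∀ p xs → 0 < entry xs p → suc (sum (xs ⁽ p ⁾)) ≡ sum xs
suc-sum-⁽⁾ p xs pos = trans (cong suc (sum-stripZeros (decAt p xs))) (suc-sum-decAt p xs pos)

psum-⁽⁾-≤⇔ : ∀ p q μ λ′ → 0 < entry μ p → 0 < entry λ′ q →
             ∀ j → psum λ′ j ≤ psum μ j →
             psum (λ′ ⁽ q ⁾) j ≤ psum (μ ⁽ p ⁾) j ⇔ (p ≤ j → j < q → psum λ′ j < psum μ j)
psum-⁽⁾-≤⇔ p q μ λ′ μp>0 λq>0 j le with j <? p | j <? q
... | yes j<p | yes j<q = mk⇔ (λ _ p≤j → ⊥-elim (<⇒≱ j<p p≤j)) λ _ → begin
  psum (λ′ ⁽ q ⁾) j ≡⟨ psum-⁽⁾-< q λ′ j j<q ⟩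
  psum λ′ j         ≤⟨ le ⟩
  psum μ j          ≡⟨ psum-⁽⁾-< p μ j j<p ⟨
  psum (μ ⁽ p ⁾) j  ∎
  where open ≤-Reasoning
... | yes j<p | no  j≮q = mk⇔ (λ _ p≤j → ⊥-elim (<⇒≱ j<p p≤j)) λ _ → begin
  psum (λ′ ⁽ q ⁾) j       ≤⟨ n≤1+n _ ⟩
  suc (psum (λ′ ⁽ q ⁾) j) ≡⟨ suc-psum-⁽⁾-≥ q λ′ j λq>0 (≮⇒≥ j≮q) ⟩
  psum λ′ j               ≤⟨ le ⟩
  psum μ j                ≡⟨ psum-⁽⁾-< p μ j j<p ⟨
  psum (μ ⁽ p ⁾) j        ∎
  where open ≤-Reasoning
... | no  j≮p | no  j≮q = mk⇔ (λ _ _ j<q → ⊥-elim (j≮q j<q)) λ _ → s≤s⁻¹ (begin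
  suc (psum (λ′ ⁽ q ⁾) j) ≡⟨ suc-psum-⁽⁾-≥ q λ′ j λq>0 (≮⇒≥ j≮q) ⟩
  psum λ′ j               ≤⟨ le ⟩
  psum μ j                ≡⟨ suc-psum-⁽⁾-≥ p μ j μp>0 (≮⇒≥ j≮p) ⟨
  suc (psum (μ ⁽ p ⁾) j)  ∎)
  where open ≤-Reasoning
... | no  j≮p | yes j<q = mk⇔ ≤⇒strict strict⇒≤
  where
  open ≤-Reasoning
  p≤j : p ≤ j
  p≤j = ≮⇒≥ j≮p
  ≤⇒strict : psum (λ′ ⁽ q ⁾) j ≤ psum (μ ⁽ p ⁾) j → p ≤ j → j < q → psum λ′ j < psum μ j
  ≤⇒strict le′ _ _ = begin-strict
    psum λ′ j              ≡⟨ psum-⁽⁾-< q λ′ j j<q ⟨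
    psum (λ′ ⁽ q ⁾) j      ≤⟨ le′ ⟩
    psum (μ ⁽ p ⁾) j       <⟨ n<1+n _ ⟩
    suc (psum (μ ⁽ p ⁾) j) ≡⟨ suc-psum-⁽⁾-≥ p μ j μp>0 p≤j ⟩
    psum μ j               ∎
  strict⇒≤ : (p ≤ j → j < q → psum λ′ j < psum μ j) → psum (λ′ ⁽ q ⁾) j ≤ psum (μ ⁽ p ⁾) j
  strict⇒≤ strict-in-window = s≤s⁻¹ (begin
    suc (psum (λ′ ⁽ q ⁾) j) ≡⟨ cong suc (psum-⁽⁾-< q λ′ j j<q) ⟩
    suc (psum λ′ j)         ≤⟨ strict-in-window p≤j j<q ⟩
    psum μ j                ≡⟨ suc-psum-⁽⁾-≥ p μ j μp>0 p≤j ⟨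
    suc (psum (μ ⁽ p ⁾) j)  ∎)

∀-window⇔ : ∀ p q (P : ℕ → Set) →
            (∀ j → p ≤ j → j < q → P j) ⇔ (q ≤ p ⊎ (p < q × (∀ j → p ≤ j → j < q → P j)))
∀-window⇔ p q P = mk⇔ to from
  where
  to : (∀ j → p ≤ j → j < q → P j) → q ≤ p ⊎ (p < q × (∀ j → p ≤ j → j < q → P j))
  to h with q ≤? p
  ... | yes q≤p = inj₁ q≤p
  ... | no  q≰p = inj₂ (≰⇒> q≰p , h)
  from : q ≤ p ⊎ (p < q × (∀ j → p ≤ j → j < q → P j)) → ∀ j → p ≤ j → j < q → P j
  from (inj₁ q≤p)    j p≤j j<q = ⊥-elim (<⇒≱ j<q (≤-trans q≤p p≤j))
  from (inj₂ (_ , h))          = h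

∀-⇔ : {P Q : ℕ → Set} → (∀ j → P j ⇔ Q j) → (∀ j → P j) ⇔ (∀ j → Q j)
∀-⇔ P⇔Q = mk⇔ (λ h j → Equivalence.to (P⇔Q j) (h j)) (λ h j → Equivalence.from (P⇔Q j) (h j))

-- The hypotheses μ_p > μ_{p+1} and λ_q > λ_{q+1} only enter through μ_p > 0
-- and λ_q > 0 (which also give p, q ≥ 1): they make μ^(p) and λ^(q) partitions,
-- but the comparison of partial sums does not need that.
lemma2p2 : (n p q : ℕ) (μ λ′ : List ℕ) →
    1 ≤ p → 1 ≤ q →
    IsPartition n μ → IsPartition n λ′ →
    entry μ (suc p) < entry μ p → entry λ′ (suc q) < entry λ′ q →
    μ ⊵ λ′ →
    ((μ ⁽ p ⁾) ⊵ (λ′ ⁽ q ⁾)) ⇔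
    (q ≤ p ⊎ (p < q × (∀ j → p ≤ j → j < q → psum λ′ j < psum μ j)))
lemma2p2 n p q μ λ′ _ _ (_ , _ , sumμ) (_ , _ , sumλ) μp>μp+1 λq>λq+1 μ⊵λ =
  ⇔-trans (mk⇔ (⊵⇒psum-≤ (μ ⁽ p ⁾) (λ′ ⁽ q ⁾) sums⁽⁾≡)
                (psum-≤⇒⊵ (μ ⁽ p ⁾) (λ′ ⁽ q ⁾) (tailSumsPositive-stripZeros (decAt p μ)) sums⁽⁾≡))
  (⇔-trans (∀-⇔ λ j → psum-⁽⁾-≤⇔ p q μ λ′ μp>0 λq>0 j (psums-≤ j))
           (∀-window⇔ p q (λ j → psum λ′ j < psum μ j)))
  where
  μp>0 : 0 < entry μ p
  μp>0 = ≤-<-trans z≤n μp>μp+1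
  λq>0 : 0 < entry λ′ q
  λq>0 = ≤-<-trans z≤n λq>λq+1
  sums≡ : sum μ ≡ sum λ′
  sums≡ = trans sumμ (sym sumλ)
  psums-≤ : ∀ j → psum λ′ j ≤ psum μ j
  psums-≤ = ⊵⇒psum-≤ μ λ′ sums≡ μ⊵λ
  sums⁽⁾≡ : sum (μ ⁽ p ⁾) ≡ sum (λ′ ⁽ q ⁾)
  sums⁽⁾≡ = suc-injective (trans (suc-sum-⁽⁾ p μ μp>0)
                          (trans sums≡ (sym (suc-sum-⁽⁾ q λ′ λq>0))))
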